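{- Let $s$ be a positive integer. For all integers $n$ and $k$ with $2\le k\le n$, $$\left\{ {n \atop k} \right\}_s=\sum_{j=1}^{k-1}\frac{j^{(k-1)s}\bigl(j^{(n-k+1)s}-k^{(n-k+1)s}\bigr)}{\prod_{i=0,\, i\neq j}^{k}(j^s-i^s)},$$ and $\left\{ {n \atop 1} \right\}_s=1$ for all $n\ge 1$.
   Context: For a positive integer $s$, the Stirling numbers of the second kind with level $s$, $\left\{ {n \atop k} \right\}_s$ ($n,k\ge 0$), are defined by the recurrence $\left\{ {n \atop k} \right\}_s=\left\{ {n-1 \atop k-1} \right\}_s+k^s\left\{ {n-1 \atop k} \right\}_s$ with $\left\{ {0 \atop 0} \right\}_s=1$ and $\left\{ {n \atop 0} \right\}_s=\left\{ {0 \atop n} \right\}_s=0$ for $n\ge 1$. Equivalently, $\left\{ {n \atop k} \right\}_s$ is the number of ordered $s$-tuples $(\pi_1,\dots,\pi_s)$ of set partitions of $\{1,\dots,n\}$ into exactly $k$ nonempty blocks such that the sets of block minima of $\pi_1,\dots,\pi_s$ all coincide. -}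

module Defs where

open import Data.Nat as ℕ using (ℕ; zero; suc)
open import Data.Integer as ℤ using (ℤ)
open import Data.Rational as ℚ using (ℚ; 0ℚ; 1ℚ; _+_; _*_; _-_; _÷_; ≢-nonZero)
open import Relation.Nullary using (yes; no)
open import Relation.Binary.PropositionalEquality using (_≡_)

stirling2 : ℕ → ℕ → ℕ → ℕ
stirling2 s zero    zero    = 1
stirling2 s zero    (suc k) = 0
stirling2 s (suc n) zero    = 0
stirling2 s (suc n) (suc k) = stirling2 s n k ℕ.+ (suc k) ℕ.^ s ℕ.* stirling2 s n (suc k)

⟦_⟧ : ℕ → ℚ
⟦ n ⟧ = (ℤ.+ n) ℚ./ 1

-- total division on ℚ (x / 0 := 0); only ever applied to nonzero denominators below
_//_ : ℚ → ℚ → ℚ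
p // q with q ℚ.≟ 0ℚ
... | yes _ = 0ℚ
... | no q≢0 = _÷_ p q {{≢-nonZero q≢0}}

sumFromTo : ℕ → ℕ → (ℕ → ℚ) → ℚ
sumFromTo a zero    f with a ℕ.≟ 0
... | yes _ = f 0
... | no _  = 0ℚ
sumFromTo a (suc b) f with a ℕ.≤? suc b
... | yes _ = sumFromTo a b f + f (suc b)
... | no _  = 0ℚ

prodSkip : ℕ → ℕ → (ℕ → ℚ) → ℚ
prodSkip j zero    g with j ℕ.≟ 0
... | yes _ = 1ℚ
... | no _  = g 0
prodSkip j (suc k) g with j ℕ.≟ suc k
... | yes _ = prodSkip j k g
... | no _  = prodSkip j k g * g (suc k)

{-# OPTIONS --safe #-}
-- Put y i = i ^ s.  The divided difference of x ↦ x ^ e at the nodes y 0, …, y L,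
--   D e L = ∑_{t ≤ L} (y t) ^ e / ∏_{u ≤ L, u ≠ t} (y t - y u),
-- satisfies D (e + 1) (L + 1) = D e L + y (L + 1) · D e (L + 1), the recurrence of
-- the level-s Stirling numbers.  The classical recursion
--   (y (L + 1) - y 0) · D e (L + 1) = D′ e L - D e L,
-- where D′ uses the nodes y 1, …, y (L + 1), gives by induction on L that D e L
-- vanishes for e < L and D L L = 1, so the initial values agree as well and
-- {n \atop k}_s = D n k.  As y 0 = 0 the term t = 0 drops, and subtracting
-- y k ^ (n - k + 1) · D (k - 1) k = 0 kills the term t = k.
module Submission where

open import Defs
open import Data.Nat using (ℕ; _≤_; _+_; _∸_; _*_; _^_)
open import Data.Product using (_×_)
open import Data.Rational as ℚ using (ℚ)
open import Relation.Binary.PropositionalEquality using (_≡_)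

open import Algebra.Bundles using (Ring)
open import Data.Integer as ℤ using (+_)
import Data.Integer.Properties as ℤₚ
open import Data.Nat as ℕ using (zero; suc; z≤n; s≤s; _<_; NonZero)
import Data.Nat.Properties as ℕₚ
open import Data.Product using (_,_)
open import Data.Rational using (0ℚ; 1ℚ; 1/_; ≢-nonZero)
import Data.Rational.Properties as ℚₚ
open import Algebra.Properties.Group ℚₚ.+-0-group using (x∙y⁻¹≈ε⇒x≈y)
open import Algebra.Properties.Semiring.Exp (Ring.semiring ℚₚ.+-*-ring) using (^-homo-*) renaming (_^_ to _^ℚ_)
open import Data.Rational.Unnormalised as ℚᵘ using (ℚᵘ; mkℚᵘ; _≃_; *≡*)
import Data.Rational.Unnormalised.Properties as ℚᵘₚ
open import Data.Sum using (inj₁; inj₂)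
open import Function using (_∘_)
open import Function.Definitions using (Injective)
open import Level using (0ℓ)
open import Relation.Binary using (tri<; tri≈; tri>)
open import Relation.Binary.PropositionalEquality using (_≢_; refl; sym; trans; cong; cong₂; module ≡-Reasoning)
open import Relation.Nullary using (Dec; yes; no; contradiction)
open import Relation.Nullary.Decidable using (dec⇒maybe)
open import Tactic.RingSolver using (solve-∀)
open import Tactic.RingSolver.Core.AlmostCommutativeRing using (AlmostCommutativeRing; fromCommutativeRing)

ℚ-ring : AlmostCommutativeRing 0ℓ 0ℓ
ℚ-ring = fromCommutativeRing ℚₚ.+-*-commutativeRing (λ q → dec⇒maybe (0ℚ ℚ.≟ q))

ι : ℕ → ℚᵘ
ι n = mkℚᵘ (+ n) 0

toℚᵘ-⟦⟧ : ∀ n → ℚ.toℚᵘ ⟦ n ⟧ ≃ ι n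
toℚᵘ-⟦⟧ n = ℚₚ.toℚᵘ-fromℚᵘ (ι n)

⟦⟧-+ : ∀ m n → ⟦ m + n ⟧ ≡ ⟦ m ⟧ ℚ.+ ⟦ n ⟧
⟦⟧-+ m n = ℚₚ.toℚᵘ-injective (begin
  ℚ.toℚᵘ ⟦ m + n ⟧                        ≈⟨ toℚᵘ-⟦⟧ (m + n) ⟩
  ι (m + n)                               ≈⟨ ℚᵘₚ.≃-reflexive (cong (λ i → mkℚᵘ i 0) ι-+) ⟩
  ι m ℚᵘ.+ ι n                            ≈⟨ ℚᵘₚ.+-cong (ℚᵘₚ.≃-sym (toℚᵘ-⟦⟧ m)) (ℚᵘₚ.≃-sym (toℚᵘ-⟦⟧ n)) ⟩
  ℚ.toℚᵘ ⟦ m ⟧ ℚᵘ.+ ℚ.toℚᵘ ⟦ n ⟧          ≈⟨ ℚᵘₚ.≃-sym (ℚₚ.toℚᵘ-homo-+ ⟦ m ⟧ ⟦ n ⟧) ⟩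
  ℚ.toℚᵘ (⟦ m ⟧ ℚ.+ ⟦ n ⟧)                ∎)
  where
  open ℚᵘₚ.≃-Reasoning
  ι-+ : + (m + n) ≡ + m ℤ.* + 1 ℤ.+ + n ℤ.* + 1
  ι-+ = trans (ℤₚ.pos-+ m n) (sym (cong₂ ℤ._+_ (ℤₚ.*-identityʳ (+ m)) (ℤₚ.*-identityʳ (+ n))))

⟦⟧-* : ∀ m n → ⟦ m * n ⟧ ≡ ⟦ m ⟧ ℚ.* ⟦ n ⟧
⟦⟧-* m n = ℚₚ.toℚᵘ-injective (begin
  ℚ.toℚᵘ ⟦ m * n ⟧                        ≈⟨ toℚᵘ-⟦⟧ (m * n) ⟩
  ι (m * n)                               ≈⟨ ℚᵘₚ.≃-reflexive (cong (λ i → mkℚᵘ i 0) (ℤₚ.pos-* m n)) ⟩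
  ι m ℚᵘ.* ι n                            ≈⟨ ℚᵘₚ.*-cong (ℚᵘₚ.≃-sym (toℚᵘ-⟦⟧ m)) (ℚᵘₚ.≃-sym (toℚᵘ-⟦⟧ n)) ⟩
  ℚ.toℚᵘ ⟦ m ⟧ ℚᵘ.* ℚ.toℚᵘ ⟦ n ⟧          ≈⟨ ℚᵘₚ.≃-sym (ℚₚ.toℚᵘ-homo-* ⟦ m ⟧ ⟦ n ⟧) ⟩
  ℚ.toℚᵘ (⟦ m ⟧ ℚ.* ⟦ n ⟧)                ∎)
  where open ℚᵘₚ.≃-Reasoning

⟦⟧-^ : ∀ m e → ⟦ m ^ e ⟧ ≡ ⟦ m ⟧ ^ℚ e
⟦⟧-^ m zero    = refl
⟦⟧-^ m (suc e) = trans (⟦⟧-* m (m ^ e)) (cong (⟦ m ⟧ ℚ.*_) (⟦⟧-^ m e))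

⟦⟧-injective : Injective _≡_ _≡_ ⟦_⟧
⟦⟧-injective {m} {n} eq
  with ℚᵘₚ.≃-trans (ℚᵘₚ.≃-sym (toℚᵘ-⟦⟧ m)) (ℚᵘₚ.≃-trans (ℚₚ.toℚᵘ-cong eq) (toℚᵘ-⟦⟧ n))
... | *≡* m*1≡n*1 = ℤₚ.+-injective (begin
  + m          ≡⟨ sym (ℤₚ.*-identityʳ (+ m)) ⟩
  + m ℤ.* + 1  ≡⟨ m*1≡n*1 ⟩
  + n ℤ.* + 1  ≡⟨ ℤₚ.*-identityʳ (+ n) ⟩
  + n          ∎)
  where open ≡-Reasoning

sub≡0⇒≡ : ∀ {p q} → p ℚ.- q ≡ 0ℚ → p ≡ q
sub≡0⇒≡ {p} {q} = x∙y⁻¹≈ε⇒x≈y p q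

p*q≡0⇒q≡0 : ∀ {p q} → p ≢ 0ℚ → p ℚ.* q ≡ 0ℚ → q ≡ 0ℚ
p*q≡0⇒q≡0 {p} {q} p≢0 p*q≡0 = begin
  q                    ≡⟨ sym (ℚₚ.*-identityˡ q) ⟩
  1ℚ ℚ.* q             ≡⟨ cong (ℚ._* q) (sym (ℚₚ.*-inverseˡ p)) ⟩
  (1/ p ℚ.* p) ℚ.* q   ≡⟨ ℚₚ.*-assoc (1/ p) p q ⟩
  1/ p ℚ.* (p ℚ.* q)   ≡⟨ cong (1/ p ℚ.*_) p*q≡0 ⟩
  1/ p ℚ.* 0ℚ          ≡⟨ ℚₚ.*-zeroʳ (1/ p) ⟩
  0ℚ                   ∎
  where
  open ≡-Reasoning
  instance
    p-nonZero : ℚ.NonZero p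
    p-nonZero = ≢-nonZero p≢0

//-as-* : ∀ p q → p // q ≡ p ℚ.* (1ℚ // q)
//-as-* p q with q ℚ.≟ 0ℚ
... | yes _ = sym (ℚₚ.*-zeroʳ p)
... | no  _ = cong (p ℚ.*_) (sym (ℚₚ.*-identityˡ _))

1//q*q≡1 : ∀ {q} → q ≢ 0ℚ → (1ℚ // q) ℚ.* q ≡ 1ℚ
1//q*q≡1 {q} q≢0 with q ℚ.≟ 0ℚ
... | yes q≡0 = contradiction q≡0 q≢0
... | no  q≢0′ = trans (cong (ℚ._* q) (ℚₚ.*-identityˡ (1/ q))) (ℚₚ.*-inverseˡ q)
  where
  instance
    q-nonZero : ℚ.NonZero q
    q-nonZero = ≢-nonZero q≢0′

-- Also true for p = 0, where both sides are 0 because x // 0 = 0.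
1//[p*q]*q≡1//p : ∀ p {q} → q ≢ 0ℚ → (1ℚ // (p ℚ.* q)) ℚ.* q ≡ 1ℚ // p
1//[p*q]*q≡1//p p {q} q≢0 = by-cases (p ℚ.≟ 0ℚ)
  where
  by-cases : Dec (p ≡ 0ℚ) → (1ℚ // (p ℚ.* q)) ℚ.* q ≡ 1ℚ // p
  by-cases (yes refl) = trans (cong (λ r → (1ℚ // r) ℚ.* q) (ℚₚ.*-zeroˡ q)) (ℚₚ.*-zeroˡ q)
  by-cases (no p≢0) = begin
    X ℚ.* q                    ≡⟨ sym (ℚₚ.*-identityʳ (X ℚ.* q)) ⟩
    X ℚ.* q ℚ.* 1ℚ             ≡⟨ cong (X ℚ.* q ℚ.*_) (sym (1//q*q≡1 p≢0)) ⟩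
    X ℚ.* q ℚ.* (Y ℚ.* p)      ≡⟨ regroup X q Y p ⟩
    X ℚ.* (p ℚ.* q) ℚ.* Y      ≡⟨ cong (ℚ._* Y) (1//q*q≡1 (p≢0 ∘ p*q≡0⇒p≡0)) ⟩
    1ℚ ℚ.* Y                   ≡⟨ ℚₚ.*-identityˡ Y ⟩
    Y                          ∎
    where
    open ≡-Reasoning
    X Y : ℚ
    X = 1ℚ // (p ℚ.* q)
    Y = 1ℚ // p
    p*q≡0⇒p≡0 : p ℚ.* q ≡ 0ℚ → p ≡ 0ℚ
    p*q≡0⇒p≡0 eq = p*q≡0⇒q≡0 q≢0 (trans (ℚₚ.*-comm q p) eq)
    regroup : ∀ x q y p → x ℚ.* q ℚ.* (y ℚ.* p) ≡ x ℚ.* (p ℚ.* q) ℚ.* y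
    regroup = solve-∀ ℚ-ring

-- Finite sums and products over initial segments of ℕ

∑< : ℕ → (ℕ → ℚ) → ℚ
∑< zero    f = 0ℚ
∑< (suc n) f = ∑< n f ℚ.+ f n

∏<∖ : ℕ → ℕ → (ℕ → ℚ) → ℚ
∏<∖ zero    t g = 1ℚ
∏<∖ (suc n) t g with t ℕ.≟ n
... | yes _ = ∏<∖ n t g
... | no  _ = ∏<∖ n t g ℚ.* g n

∑<-cong : ∀ n {f g : ℕ → ℚ} → (∀ t → t < n → f t ≡ g t) → ∑< n f ≡ ∑< n g
∑<-cong zero    f≡g = refl
∑<-cong (suc n) f≡g = cong₂ ℚ._+_ (∑<-cong n (λ t t<n → f≡g t (ℕₚ.m<n⇒m<1+n t<n))) (f≡g n (ℕₚ.n<1+n n))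

∑<-distrib-+ : ∀ n f g → ∑< n (λ t → f t ℚ.+ g t) ≡ ∑< n f ℚ.+ ∑< n g
∑<-distrib-+ zero    f g = refl
∑<-distrib-+ (suc n) f g = trans (cong (ℚ._+ (f n ℚ.+ g n)) (∑<-distrib-+ n f g)) (interchange (∑< n f) (∑< n g) (f n) (g n))
  where
  interchange : ∀ a b c d → a ℚ.+ b ℚ.+ (c ℚ.+ d) ≡ a ℚ.+ c ℚ.+ (b ℚ.+ d)
  interchange = solve-∀ ℚ-ring

∑<-distrib-- : ∀ n f g → ∑< n (λ t → f t ℚ.- g t) ≡ ∑< n f ℚ.- ∑< n g
∑<-distrib-- zero    f g = refl
∑<-distrib-- (suc n) f g = trans (cong (ℚ._+ (f n ℚ.- g n)) (∑<-distrib-- n f g)) (interchange (∑< n f) (∑< n g) (f n) (g n))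
  where
  interchange : ∀ a b c d → a ℚ.- b ℚ.+ (c ℚ.- d) ≡ a ℚ.+ c ℚ.- (b ℚ.+ d)
  interchange = solve-∀ ℚ-ring

*-distribˡ-∑< : ∀ n c f → c ℚ.* ∑< n f ≡ ∑< n (λ t → c ℚ.* f t)
*-distribˡ-∑< zero    c f = ℚₚ.*-zeroʳ c
*-distribˡ-∑< (suc n) c f = trans (ℚₚ.*-distribˡ-+ c (∑< n f) (f n)) (cong (ℚ._+ c ℚ.* f n) (*-distribˡ-∑< n c f))

∑<-front : ∀ n f → ∑< (suc n) f ≡ f 0 ℚ.+ ∑< n (f ∘ suc)
∑<-front zero    f = trans (ℚₚ.+-identityˡ (f 0)) (sym (ℚₚ.+-identityʳ (f 0)))
∑<-front (suc n) f = trans (cong (ℚ._+ f (suc n)) (∑<-front n f)) (ℚₚ.+-assoc (f 0) _ _)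

∑<-ends : ∀ n f → ∑< (suc (suc n)) f ≡ f 0 ℚ.+ ∑< n (f ∘ suc) ℚ.+ f (suc n)
∑<-ends n f = cong (ℚ._+ f (suc n)) (∑<-front n f)

∏<∖-last : ∀ n {t} g → t ≢ n → ∏<∖ (suc n) t g ≡ ∏<∖ n t g ℚ.* g n
∏<∖-last n {t} g t≢n with t ℕ.≟ n
... | yes t≡n = contradiction t≡n t≢n
... | no  _   = refl

∏<∖-front : ∀ n t g → ∏<∖ (suc n) (suc t) g ≡ g 0 ℚ.* ∏<∖ n t (g ∘ suc)
∏<∖-front zero    t g = trans (ℚₚ.*-identityˡ (g 0)) (sym (ℚₚ.*-identityʳ (g 0)))
∏<∖-front (suc n) t g with suc t ℕ.≟ suc n | t ℕ.≟ n
... | yes _       | yes _   = ∏<∖-front n t g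
... | yes 1+t≡1+n | no  t≢n = contradiction (ℕₚ.suc-injective 1+t≡1+n) t≢n
... | no  1+t≢1+n | yes t≡n = contradiction (cong suc t≡n) 1+t≢1+n
... | no  _       | no  _   = trans (cong (ℚ._* g (suc n)) (∏<∖-front n t g)) (ℚₚ.*-assoc (g 0) _ _)

-- Divided differences of the powers x ↦ x ^ e

weight : (ℕ → ℚ) → ℕ → ℕ → ℚ
weight y L t = 1ℚ // ∏<∖ (suc L) t (λ u → y t ℚ.- y u)

divDiff : ℕ → (ℕ → ℚ) → ℕ → ℚ
divDiff e y L = ∑< (suc L) (λ t → y t ^ℚ e ℚ.* weight y L t)

p*[w*[x-x]]≡0 : ∀ p w x → p ℚ.* (w ℚ.* (x ℚ.- x)) ≡ 0ℚ
p*[w*[x-x]]≡0 = solve-∀ ℚ-ring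

module _ {y : ℕ → ℚ} (y-inj : Injective _≡_ _≡_ y) where

  node-sub-nonZero : ∀ {i j} → i ≢ j → y i ℚ.- y j ≢ 0ℚ
  node-sub-nonZero i≢j = i≢j ∘ y-inj ∘ sub≡0⇒≡

  weight-*-last : ∀ L t → t < suc L → weight y (suc L) t ℚ.* (y t ℚ.- y (suc L)) ≡ weight y L t
  weight-*-last L t t≤L = trans
    (cong (λ p → (1ℚ // p) ℚ.* (y t ℚ.- y (suc L))) (∏<∖-last (suc L) (λ u → y t ℚ.- y u) t≢1+L))
    (1//[p*q]*q≡1//p (∏<∖ (suc L) t (λ u → y t ℚ.- y u)) (node-sub-nonZero t≢1+L))
    where
    t≢1+L : t ≢ suc L
    t≢1+L = ℕₚ.<⇒≢ t≤L

  weight-*-first : ∀ L t → weight y (suc L) (suc t) ℚ.* (y (suc t) ℚ.- y 0) ≡ weight (y ∘ suc) L t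
  weight-*-first L t = trans
    (cong (λ p → (1ℚ // p) ℚ.* (y (suc t) ℚ.- y 0))
      (trans (∏<∖-front (suc L) t (λ u → y (suc t) ℚ.- y u)) (ℚₚ.*-comm (y (suc t) ℚ.- y 0) _)))
    (1//[p*q]*q≡1//p (∏<∖ (suc L) t (λ u → y (suc t) ℚ.- y (suc u))) (node-sub-nonZero (λ ())))

  ∑<-weight-*-last : ∀ e L →
    ∑< (suc (suc L)) (λ t → y t ^ℚ e ℚ.* (weight y (suc L) t ℚ.* (y t ℚ.- y (suc L)))) ≡ divDiff e y L
  ∑<-weight-*-last e L = begin
    ∑< (suc L) F ℚ.+ F (suc L)
      ≡⟨ cong₂ ℚ._+_ (∑<-cong (suc L) F≡) (p*[w*[x-x]]≡0 (y (suc L) ^ℚ e) (weight y (suc L) (suc L)) (y (suc L))) ⟩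
    divDiff e y L ℚ.+ 0ℚ
      ≡⟨ ℚₚ.+-identityʳ (divDiff e y L) ⟩
    divDiff e y L ∎
    where
    open ≡-Reasoning
    F : ℕ → ℚ
    F t = y t ^ℚ e ℚ.* (weight y (suc L) t ℚ.* (y t ℚ.- y (suc L)))
    F≡ : ∀ t → t < suc L → F t ≡ y t ^ℚ e ℚ.* weight y L t
    F≡ t t≤L = cong (y t ^ℚ e ℚ.*_) (weight-*-last L t t≤L)

  ∑<-weight-*-first : ∀ e L →
    ∑< (suc (suc L)) (λ t → y t ^ℚ e ℚ.* (weight y (suc L) t ℚ.* (y t ℚ.- y 0))) ≡ divDiff e (y ∘ suc) L
  ∑<-weight-*-first e L = begin
    ∑< (suc (suc L)) F
      ≡⟨ ∑<-front (suc L) F ⟩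
    F 0 ℚ.+ ∑< (suc L) (F ∘ suc)
      ≡⟨ cong₂ ℚ._+_ (p*[w*[x-x]]≡0 (y 0 ^ℚ e) (weight y (suc L) 0) (y 0)) (∑<-cong (suc L) F≡) ⟩
    0ℚ ℚ.+ divDiff e (y ∘ suc) L
      ≡⟨ ℚₚ.+-identityˡ (divDiff e (y ∘ suc) L) ⟩
    divDiff e (y ∘ suc) L ∎
    where
    open ≡-Reasoning
    F : ℕ → ℚ
    F t = y t ^ℚ e ℚ.* (weight y (suc L) t ℚ.* (y t ℚ.- y 0))
    F≡ : ∀ t → t < suc L → F (suc t) ≡ y (suc t) ^ℚ e ℚ.* weight (y ∘ suc) L t
    F≡ t _ = cong (y (suc t) ^ℚ e ℚ.*_) (weight-*-first L t)

  divDiff-suc : ∀ e L → divDiff (suc e) y (suc L) ≡ divDiff e y L ℚ.+ y (suc L) ℚ.* divDiff e y (suc L)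
  divDiff-suc e L = begin
    ∑< (suc (suc L)) (λ t → y t ^ℚ suc e ℚ.* W t)
      ≡⟨ ∑<-cong (suc (suc L)) (λ t _ → split (y t) (y t ^ℚ e) (W t) Y) ⟩
    ∑< (suc (suc L)) (λ t → y t ^ℚ e ℚ.* (W t ℚ.* (y t ℚ.- Y)) ℚ.+ Y ℚ.* (y t ^ℚ e ℚ.* W t))
      ≡⟨ ∑<-distrib-+ (suc (suc L)) _ _ ⟩
    ∑< (suc (suc L)) (λ t → y t ^ℚ e ℚ.* (W t ℚ.* (y t ℚ.- Y))) ℚ.+ ∑< (suc (suc L)) (λ t → Y ℚ.* (y t ^ℚ e ℚ.* W t))
      ≡⟨ cong₂ ℚ._+_ (∑<-weight-*-last e L) (sym (*-distribˡ-∑< (suc (suc L)) Y _)) ⟩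
    divDiff e y L ℚ.+ Y ℚ.* divDiff e y (suc L) ∎
    where
    open ≡-Reasoning
    Y : ℚ
    Y = y (suc L)
    W : ℕ → ℚ
    W = weight y (suc L)
    split : ∀ x p w Y → x ℚ.* p ℚ.* w ≡ p ℚ.* (w ℚ.* (x ℚ.- Y)) ℚ.+ Y ℚ.* (p ℚ.* w)
    split = solve-∀ ℚ-ring

  divDiff-recursion : ∀ e L → (y (suc L) ℚ.- y 0) ℚ.* divDiff e y (suc L) ≡ divDiff e (y ∘ suc) L ℚ.- divDiff e y L
  divDiff-recursion e L = begin
    (Y ℚ.- Z) ℚ.* divDiff e y (suc L)
      ≡⟨ *-distribˡ-∑< (suc (suc L)) (Y ℚ.- Z) _ ⟩
    ∑< (suc (suc L)) (λ t → (Y ℚ.- Z) ℚ.* (y t ^ℚ e ℚ.* W t))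
      ≡⟨ ∑<-cong (suc (suc L)) (λ t _ → split (y t) (y t ^ℚ e) (W t) Y Z) ⟩
    ∑< (suc (suc L)) (λ t → y t ^ℚ e ℚ.* (W t ℚ.* (y t ℚ.- Z)) ℚ.- y t ^ℚ e ℚ.* (W t ℚ.* (y t ℚ.- Y)))
      ≡⟨ ∑<-distrib-- (suc (suc L)) _ _ ⟩
    ∑< (suc (suc L)) (λ t → y t ^ℚ e ℚ.* (W t ℚ.* (y t ℚ.- Z))) ℚ.- ∑< (suc (suc L)) (λ t → y t ^ℚ e ℚ.* (W t ℚ.* (y t ℚ.- Y)))
      ≡⟨ cong₂ ℚ._-_ (∑<-weight-*-first e L) (∑<-weight-*-last e L) ⟩
    divDiff e (y ∘ suc) L ℚ.- divDiff e y L ∎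
    where
    open ≡-Reasoning
    Y Z : ℚ
    Y = y (suc L)
    Z = y 0
    W : ℕ → ℚ
    W = weight y (suc L)
    split : ∀ x p w Y Z → (Y ℚ.- Z) ℚ.* (p ℚ.* w) ≡ p ℚ.* (w ℚ.* (x ℚ.- Z)) ℚ.- p ℚ.* (w ℚ.* (x ℚ.- Y))
    split = solve-∀ ℚ-ring

divDiff-below : ∀ {y} → Injective _≡_ _≡_ y → ∀ {e L} → e < L → divDiff e y L ≡ 0ℚ
divDiff-diagonal : ∀ {y} → Injective _≡_ _≡_ y → ∀ L → divDiff L y L ≡ 1ℚ
divDiff-shift-invariant : ∀ {y} → Injective _≡_ _≡_ y → ∀ {e L} → e ≤ L → divDiff e (y ∘ suc) L ≡ divDiff e y L

divDiff-below {y} y-inj {e} {suc L} e<1+L =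
  p*q≡0⇒q≡0 (node-sub-nonZero y-inj (λ ())) (begin
    (y (suc L) ℚ.- y 0) ℚ.* divDiff e y (suc L)
      ≡⟨ divDiff-recursion y-inj e L ⟩
    divDiff e (y ∘ suc) L ℚ.- divDiff e y L
      ≡⟨ cong (ℚ._- divDiff e y L) (divDiff-shift-invariant y-inj (ℕₚ.≤-pred e<1+L)) ⟩
    divDiff e y L ℚ.- divDiff e y L
      ≡⟨ ℚₚ.+-inverseʳ (divDiff e y L) ⟩
    0ℚ ∎)
  where open ≡-Reasoning

divDiff-diagonal y-inj zero    = refl
divDiff-diagonal {y} y-inj (suc L) = begin
  divDiff (suc L) y (suc L)
    ≡⟨ divDiff-suc y-inj L L ⟩
  divDiff L y L ℚ.+ y (suc L) ℚ.* divDiff L y (suc L)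
    ≡⟨ cong₂ (λ d d′ → d ℚ.+ y (suc L) ℚ.* d′) (divDiff-diagonal y-inj L) (divDiff-below y-inj (ℕₚ.n<1+n L)) ⟩
  1ℚ ℚ.+ y (suc L) ℚ.* 0ℚ
    ≡⟨ cong (1ℚ ℚ.+_) (ℚₚ.*-zeroʳ (y (suc L))) ⟩
  1ℚ ∎
  where open ≡-Reasoning

divDiff-shift-invariant y-inj {e} {L} e≤L with ℕₚ.m≤n⇒m<n∨m≡n e≤L
... | inj₁ e<L  = trans (divDiff-below (ℕₚ.suc-injective ∘ y-inj) e<L) (sym (divDiff-below y-inj e<L))
... | inj₂ refl = trans (divDiff-diagonal (ℕₚ.suc-injective ∘ y-inj) L) (sym (divDiff-diagonal y-inj L))

divDiff-closedForm : ∀ {y} → Injective _≡_ _≡_ y → y 0 ≡ 0ℚ → ∀ a c →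
  divDiff (suc a + c) y (suc (suc a)) ≡
    ∑< (suc a) (λ t → (y (suc t) ^ℚ suc a ℚ.* (y (suc t) ^ℚ c ℚ.- y (suc (suc a)) ^ℚ c)) ℚ.* weight y (suc (suc a)) (suc t))
divDiff-closedForm {y} y-inj y0≡0 a c = begin
  D
    ≡⟨ sym (trans (cong (λ d → D ℚ.- K ℚ.* d) (divDiff-below y-inj (ℕₚ.n<1+n (suc a)))) (minus-zero D K)) ⟩
  D ℚ.- K ℚ.* divDiff (suc a) y k
    ≡⟨ cong (λ s → D ℚ.- s) (*-distribˡ-∑< (suc k) K _) ⟩
  D ℚ.- ∑< (suc k) (λ t → K ℚ.* (y t ^ℚ suc a ℚ.* W t))
    ≡⟨ sym (∑<-distrib-- (suc k) _ _) ⟩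
  ∑< (suc k) (λ t → y t ^ℚ (suc a + c) ℚ.* W t ℚ.- K ℚ.* (y t ^ℚ suc a ℚ.* W t))
    ≡⟨ ∑<-cong (suc k) (λ t _ → factor t) ⟩
  ∑< (suc k) H
    ≡⟨ ∑<-ends (suc a) H ⟩
  H 0 ℚ.+ ∑< (suc a) (H ∘ suc) ℚ.+ H k
    ≡⟨ cong₂ (λ h h′ → h ℚ.+ ∑< (suc a) (H ∘ suc) ℚ.+ h′) H0≡0 (Hk≡0 (y k ^ℚ suc a) K (W k)) ⟩
  0ℚ ℚ.+ ∑< (suc a) (H ∘ suc) ℚ.+ 0ℚ
    ≡⟨ zero-ends (∑< (suc a) (H ∘ suc)) ⟩
  ∑< (suc a) (H ∘ suc) ∎
  where
  open ≡-Reasoning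
  k : ℕ
  k = suc (suc a)
  D K : ℚ
  D = divDiff (suc a + c) y k
  K = y k ^ℚ c
  W : ℕ → ℚ
  W = weight y k
  H : ℕ → ℚ
  H t = (y t ^ℚ suc a ℚ.* (y t ^ℚ c ℚ.- K)) ℚ.* W t

  minus-zero : ∀ d K → d ℚ.- K ℚ.* 0ℚ ≡ d
  minus-zero = solve-∀ ℚ-ring
  zero-ends : ∀ s → 0ℚ ℚ.+ s ℚ.+ 0ℚ ≡ s
  zero-ends = solve-∀ ℚ-ring
  Hk≡0 : ∀ p K w → (p ℚ.* (K ℚ.- K)) ℚ.* w ≡ 0ℚ
  Hk≡0 = solve-∀ ℚ-ring

  factor : ∀ t → y t ^ℚ (suc a + c) ℚ.* W t ℚ.- K ℚ.* (y t ^ℚ suc a ℚ.* W t) ≡ H t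
  factor t = trans (cong (λ p → p ℚ.* W t ℚ.- K ℚ.* (y t ^ℚ suc a ℚ.* W t)) (^-homo-* (y t) (suc a) c))
                   (collect (y t ^ℚ suc a) (y t ^ℚ c) (W t) K)
    where
    collect : ∀ p q w K → p ℚ.* q ℚ.* w ℚ.- K ℚ.* (p ℚ.* w) ≡ (p ℚ.* (q ℚ.- K)) ℚ.* w
    collect = solve-∀ ℚ-ring

  H0≡0 : H 0 ≡ 0ℚ
  H0≡0 = trans (cong (λ z → (z ℚ.* y 0 ^ℚ a ℚ.* (y 0 ^ℚ c ℚ.- K)) ℚ.* W 0) y0≡0)
               (annihilate (y 0 ^ℚ a) (y 0 ^ℚ c ℚ.- K) (W 0))
    where
    annihilate : ∀ p q w → (0ℚ ℚ.* p ℚ.* q) ℚ.* w ≡ 0ℚ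
    annihilate = solve-∀ ℚ-ring

-- Level-s Stirling numbers

node : ℕ → ℕ → ℚ
node s i = ⟦ i ^ s ⟧

node-zero : ∀ s .{{_ : NonZero s}} → node s 0 ≡ 0ℚ
node-zero (suc _) = refl

^-cancelʳ-≡ : ∀ s .{{_ : NonZero s}} {i j} → i ^ s ≡ j ^ s → i ≡ j
^-cancelʳ-≡ s {i} {j} i^s≡j^s with ℕₚ.<-cmp i j
... | tri< i<j _ _ = contradiction i^s≡j^s (ℕₚ.<⇒≢ (ℕₚ.^-monoˡ-< s i<j))
... | tri≈ _ i≡j _ = i≡j
... | tri> _ _ j<i = contradiction (sym i^s≡j^s) (ℕₚ.<⇒≢ (ℕₚ.^-monoˡ-< s j<i))

node-injective : ∀ s .{{_ : NonZero s}} → Injective _≡_ _≡_ (node s)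
node-injective s = ^-cancelʳ-≡ s ∘ ⟦⟧-injective

node-^ : ∀ s j e → ⟦ j ^ (e * s) ⟧ ≡ node s j ^ℚ e
node-^ s j e = trans (cong ⟦_⟧ j^[e*s]≡[j^s]^e) (⟦⟧-^ (j ^ s) e)
  where
  j^[e*s]≡[j^s]^e : j ^ (e * s) ≡ (j ^ s) ^ e
  j^[e*s]≡[j^s]^e = trans (cong (j ^_) (ℕₚ.*-comm e s)) (sym (ℕₚ.^-*-assoc j s e))

⟦stirling2⟧≡divDiff : ∀ s .{{_ : NonZero s}} n k → ⟦ stirling2 s n k ⟧ ≡ divDiff n (node s) k
⟦stirling2⟧≡divDiff s zero    zero    = refl
⟦stirling2⟧≡divDiff s zero    (suc k) = sym (divDiff-below (node-injective s) {0} {suc k} (s≤s z≤n))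
⟦stirling2⟧≡divDiff s (suc n) zero    = sym (begin
  0ℚ ℚ.+ node s 0 ℚ.* node s 0 ^ℚ n ℚ.* weight (node s) 0 0
    ≡⟨ cong (λ z → 0ℚ ℚ.+ z ℚ.* node s 0 ^ℚ n ℚ.* weight (node s) 0 0) (node-zero s) ⟩
  0ℚ ℚ.+ 0ℚ ℚ.* node s 0 ^ℚ n ℚ.* weight (node s) 0 0
    ≡⟨ annihilate (node s 0 ^ℚ n) (weight (node s) 0 0) ⟩
  0ℚ ∎)
  where
  open ≡-Reasoning
  annihilate : ∀ p w → 0ℚ ℚ.+ 0ℚ ℚ.* p ℚ.* w ≡ 0ℚ
  annihilate = solve-∀ ℚ-ring
⟦stirling2⟧≡divDiff s (suc n) (suc k) = begin
  ⟦ stirling2 s n k + suc k ^ s * stirling2 s n (suc k) ⟧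
    ≡⟨ ⟦⟧-+ (stirling2 s n k) _ ⟩
  ⟦ stirling2 s n k ⟧ ℚ.+ ⟦ suc k ^ s * stirling2 s n (suc k) ⟧
    ≡⟨ cong (⟦ stirling2 s n k ⟧ ℚ.+_) (⟦⟧-* (suc k ^ s) (stirling2 s n (suc k))) ⟩
  ⟦ stirling2 s n k ⟧ ℚ.+ node s (suc k) ℚ.* ⟦ stirling2 s n (suc k) ⟧
    ≡⟨ cong₂ (λ d d′ → d ℚ.+ node s (suc k) ℚ.* d′) (⟦stirling2⟧≡divDiff s n k) (⟦stirling2⟧≡divDiff s n (suc k)) ⟩
  divDiff n (node s) k ℚ.+ node s (suc k) ℚ.* divDiff n (node s) (suc k)
    ≡⟨ sym (divDiff-suc (node-injective s) n k) ⟩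
  divDiff (suc n) (node s) (suc k) ∎
  where open ≡-Reasoning

stirling2-one : ∀ s n → 1 ≤ n → stirling2 s n 1 ≡ 1
stirling2-one s (suc zero)    _ = cong suc (ℕₚ.*-zeroʳ (1 ^ s))
stirling2-one s (suc (suc n)) _ = trans (cong (1 ^ s *_) (stirling2-one s (suc n) (s≤s z≤n)))
                                        (trans (ℕₚ.*-identityʳ (1 ^ s)) (ℕₚ.^-zeroˡ s))

sumFromTo-1 : ∀ b f → sumFromTo 1 b f ≡ ∑< b (f ∘ suc)
sumFromTo-1 zero    f = refl
sumFromTo-1 (suc b) f with 1 ℕ.≤? suc b
... | yes _  = cong (ℚ._+ f (suc b)) (sumFromTo-1 b f)
... | no 1≰b = contradiction (s≤s z≤n) 1≰b

prodSkip≡∏<∖ : ∀ j k g → prodSkip j k g ≡ ∏<∖ (suc k) j g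
prodSkip≡∏<∖ j zero g with j ℕ.≟ 0
... | yes _ = refl
... | no  _ = sym (ℚₚ.*-identityˡ (g 0))
prodSkip≡∏<∖ j (suc k) g with j ℕ.≟ suc k
... | yes _ = prodSkip≡∏<∖ j k g
... | no  _ = cong (ℚ._* g (suc k)) (prodSkip≡∏<∖ j k g)

m+[n∸[1+m]+1]≡n : ∀ m n → suc m ≤ n → m + (n ∸ suc m + 1) ≡ n
m+[n∸[1+m]+1]≡n m n 1+m≤n = begin
  m + (n ∸ suc m + 1)  ≡⟨ ℕₚ.+-comm m (n ∸ suc m + 1) ⟩
  n ∸ suc m + 1 + m    ≡⟨ ℕₚ.+-assoc (n ∸ suc m) 1 m ⟩
  n ∸ suc m + suc m    ≡⟨ ℕₚ.m∸n+n≡m 1+m≤n ⟩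
  n                    ∎
  where open ≡-Reasoning

summand≡weighted : ∀ s a c k j →
  (⟦ j ^ (a * s) ⟧ ℚ.* (⟦ j ^ (c * s) ⟧ ℚ.- ⟦ k ^ (c * s) ⟧)) // prodSkip j k (λ i → ⟦ j ^ s ⟧ ℚ.- ⟦ i ^ s ⟧)
    ≡ (node s j ^ℚ a ℚ.* (node s j ^ℚ c ℚ.- node s k ^ℚ c)) ℚ.* weight (node s) k j
summand≡weighted s a c k j = begin
  P // Q               ≡⟨ //-as-* P Q ⟩
  P ℚ.* (1ℚ // Q)      ≡⟨ cong₂ ℚ._*_ P≡ (cong (1ℚ //_) (prodSkip≡∏<∖ j k (λ i → ⟦ j ^ s ⟧ ℚ.- ⟦ i ^ s ⟧))) ⟩
  (node s j ^ℚ a ℚ.* (node s j ^ℚ c ℚ.- node s k ^ℚ c)) ℚ.* weight (node s) k j ∎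
  where
  open ≡-Reasoning
  P Q : ℚ
  P = ⟦ j ^ (a * s) ⟧ ℚ.* (⟦ j ^ (c * s) ⟧ ℚ.- ⟦ k ^ (c * s) ⟧)
  Q = prodSkip j k (λ i → ⟦ j ^ s ⟧ ℚ.- ⟦ i ^ s ⟧)
  P≡ : P ≡ node s j ^ℚ a ℚ.* (node s j ^ℚ c ℚ.- node s k ^ℚ c)
  P≡ = cong₂ ℚ._*_ (node-^ s j a) (cong₂ ℚ._-_ (node-^ s j c) (node-^ s k c))

stirling2-closedForm : ∀ s .{{_ : NonZero s}} a c n → n ≡ suc a + c →
  ⟦ stirling2 s n (suc (suc a)) ⟧ ≡
    sumFromTo 1 (suc a) (λ j →
      (⟦ j ^ (suc a * s) ⟧ ℚ.* (⟦ j ^ (c * s) ⟧ ℚ.- ⟦ suc (suc a) ^ (c * s) ⟧))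
      // prodSkip j (suc (suc a)) (λ i → ⟦ j ^ s ⟧ ℚ.- ⟦ i ^ s ⟧))
stirling2-closedForm s a c n refl = begin
  ⟦ stirling2 s n k ⟧                        ≡⟨ ⟦stirling2⟧≡divDiff s n k ⟩
  divDiff (suc a + c) y k                    ≡⟨ divDiff-closedForm (node-injective s) (node-zero s) a c ⟩
  ∑< (suc a) (λ t → weighted (suc t))        ≡⟨ ∑<-cong (suc a) (λ t _ → sym (summand≡weighted s (suc a) c k (suc t))) ⟩
  ∑< (suc a) (λ t → summand (suc t))         ≡⟨ sym (sumFromTo-1 (suc a) summand) ⟩
  sumFromTo 1 (suc a) summand                ∎
  where
  open ≡-Reasoning
  k : ℕ
  k = suc (suc a)
  y : ℕ → ℚ
  y = node s
  summand weighted : ℕ → ℚ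
  summand j = (⟦ j ^ (suc a * s) ⟧ ℚ.* (⟦ j ^ (c * s) ⟧ ℚ.- ⟦ k ^ (c * s) ⟧)) // prodSkip j k (λ i → ⟦ j ^ s ⟧ ℚ.- ⟦ i ^ s ⟧)
  weighted j = (y j ^ℚ suc a ℚ.* (y j ^ℚ c ℚ.- y k ^ℚ c)) ℚ.* weight y k j

theorem1 : (s : ℕ) → 1 ≤ s →
    ((n k : ℕ) → 2 ≤ k → k ≤ n →
      ⟦ stirling2 s n k ⟧ ≡
        sumFromTo 1 (k ∸ 1) (λ j →
          (⟦ j ^ ((k ∸ 1) * s) ⟧ ℚ.* (⟦ j ^ ((n ∸ k + 1) * s) ⟧ ℚ.- ⟦ k ^ ((n ∸ k + 1) * s) ⟧))
          // prodSkip j k (λ i → ⟦ j ^ s ⟧ ℚ.- ⟦ i ^ s ⟧)))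
    × ((n : ℕ) → 1 ≤ n → stirling2 s n 1 ≡ 1)
theorem1 zero ()
theorem1 s@(suc _) _ =
    (λ { n k@(suc (suc a)) (s≤s (s≤s _)) k≤n →
         stirling2-closedForm s a (n ∸ k + 1) n (sym (m+[n∸[1+m]+1]≡n (suc a) n k≤n)) })
  , stirling2-one s
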